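{- Let $X$ be a finite pure $d$-dimensional simplicial complex which is homogeneous, i.e., the links of all its vertices are isomorphic. Then for every $0\le i\le d$ and every $\alpha\in C^i(X,\mathbb{F}_2)$, $$\|\alpha\|=\frac{1}{|X(0)|}\sum_{v\in X(0)}\|\alpha_v\|,$$ where $\|\alpha_v\|$ is the norm of $\alpha_v\in C^{i-1}(X_v,\mathbb{F}_2)$ computed in the link $X_v$.
   Context: For a finite pure $d$-dimensional complex $Y$ and $\sigma\in Y(i)$ (the $i$-cells, with $Y(-1)=\{\emptyset\}$), $c_Y(\sigma)$ is the number of $d$-cells containing $\sigma$ and $w(\sigma)=c_Y(\sigma)/(\binom{d+1}{i+1}|Y(d)|)$. $C^i(Y,\mathbb{F}_2)$ is the set of functions $Y(i)\to\mathbb{F}_2$, identified with subsets of $Y(i)$, and $\|\alpha\|=\sum_{\sigma\in\alpha}w(\sigma)$. The link of a vertex $v$ is $X_v=\{\sigma\setminus\{v\}: v\in\sigma\in X\}$, a pure $(d-1)$-dimensional complex, normed with its own weights; $\alpha\in C^i(X)$ induces $\alpha_v\in C^{i-1}(X_v)$ by $\alpha_v(\sigma\setminus\{v\})=\alpha(\sigma)$ for $v\in\sigma\in X(i)$. -}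

module Defs where

open import Data.Nat using (ℕ; zero; suc; _≤_; _≡ᵇ_)
import Data.Nat
open import Data.Nat.Combinatorics using (_C_)
open import Data.Integer using (+_)
open import Data.Rational using (ℚ; _/_; _+_; _*_; 0ℚ)
open import Data.Bool using (Bool; true; false; _∧_; not; if_then_else_)
open import Data.List using (List; []; _∷_; map; filter; length; foldr; allFin; _++_)
open import Data.Vec using (Vec; lookup; tabulate; []; _∷_)
open import Data.Fin using (Fin)
open import Data.Fin.Subset using (Subset; _⊆_; ∣_∣; ⁅_⁆; _∪_; ⊥; inside; outside)
open import Data.Fin.Subset.Properties using (_⊆?_)
open import Data.Fin.Permutation using (Permutation′; _⟨$⟩ˡ_)
open import Data.Product using (Σ; _×_; _,_)
open import Relation.Binary.PropositionalEquality using (_≡_)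
open import Relation.Nullary.Decidable using (⌊_⌋)

Faces : ℕ → Set
Faces n = Subset n → Bool

allSubsets : (n : ℕ) → List (Subset n)
allSubsets zero = [] ∷ []
allSubsets (suc n) = map (outside ∷_) (allSubsets n) ++ map (inside ∷_) (allSubsets n)

record IsSimplicialComplex {n : ℕ} (X : Faces n) : Set where
  field
    hasEmpty  : X ⊥ ≡ true
    downClosed : ∀ σ τ → τ ⊆ σ → X σ ≡ true → X τ ≡ true

record IsPure {n : ℕ} (d : ℕ) (X : Faces n) : Set where
  field
    dimBound : ∀ σ → X σ ≡ true → ∣ σ ∣ ≤ suc d
    extends  : ∀ σ → X σ ≡ true → Σ (Subset n) (λ τ → σ ⊆ τ × X τ ≡ true × ∣ τ ∣ ≡ suc d)

select : {A : Set} → (A → Bool) → List A → List A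
select p [] = []
select p (x ∷ xs) = if p x then x ∷ select p xs else select p xs

sumℚ : List ℚ → ℚ
sumℚ = foldr _+_ 0ℚ

-- a / b as a rational, with the convention a / 0 = 0 (never used in the
-- situations of the lemma, where all denominators are positive).
divℚ : ℕ → ℕ → ℚ
divℚ a zero = 0ℚ
divℚ a (suc b) = (+ a) / suc b

-- Cells of X with exactly k vertices, i.e. X(k-1).
cells : {n : ℕ} → Faces n → ℕ → List (Subset n)
cells {n} X k = select (λ σ → X σ ∧ (∣ σ ∣ ≡ᵇ k)) (allSubsets n)

vertices : {n : ℕ} → Faces n → List (Fin n)
vertices X = select (λ v → X ⁅ v ⁆) (allFin _)

-- c_Y(σ) for Y pure of dimension D, with top cells of size D+1 = top.
-- (We parametrize by top = D+1 so that dimension -1 is allowed: top = 0.)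
count : {n : ℕ} → Faces n → ℕ → Subset n → ℕ
count Y top σ = length (select (λ τ → ⌊ σ ⊆? τ ⌋) (cells Y top))

-- w(σ) = c_Y(σ) / (binom(D+1, i+1) |Y(D)|), where |σ| = i+1, top = D+1.
weight : {n : ℕ} → Faces n → ℕ → Subset n → ℚ
weight Y top σ = divℚ (count Y top σ) ((top C ∣ σ ∣) Data.Nat.* length (cells Y top))

-- Norm of a cochain α ∈ C^{k-1}(Y, F₂), α given as a Boolean function on
-- subsets (only its values on Y(k-1) matter): ‖α‖ = Σ_{σ ∈ Y(k-1), α σ = 1} w(σ).
norm : {n : ℕ} → Faces n → ℕ → ℕ → (Subset n → Bool) → ℚ
norm Y top k α = sumℚ (map (weight Y top) (select α (cells Y k)))

-- Link of v: X_v = { σ ∖ {v} : v ∈ σ ∈ X }, i.e. τ ∈ X_v iff v ∉ τ and τ ∪ {v} ∈ X.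
link : {n : ℕ} → Faces n → Fin n → Faces n
link X v τ = not (lookup τ v) ∧ X (τ ∪ ⁅ v ⁆)

-- Induced cochain on the link: α_v(σ ∖ {v}) = α(σ).
restrict : {n : ℕ} → (Subset n → Bool) → Fin n → (Subset n → Bool)
restrict α v τ = α (τ ∪ ⁅ v ⁆)

image : {n : ℕ} → Permutation′ n → Subset n → Subset n
image π σ = tabulate (λ j → lookup σ (π ⟨$⟩ˡ j))

Isomorphic : {n : ℕ} → Faces n → Faces n → Set
Isomorphic {n} Y Z = Σ (Permutation′ n) (λ π → ∀ σ → Z (image π σ) ≡ Y σ)

Homogeneous : {n : ℕ} → Faces n → Set
Homogeneous {n} X = ∀ (u v : Fin n) → X ⁅ u ⁆ ≡ true → X ⁅ v ⁆ ≡ true →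
  Isomorphic (link X u) (link X v)

module Submission where

-- Write T = |X(d)|, N = |X(0)| and D = |X_v(d-1)|; D does not depend on v because all
-- links are isomorphic.  All norms are fractions of natural numbers:
--   ‖α‖   = A / (C(d+1,i+1) T)       with A   = Σ_{σ ∈ X(i), α σ = 1} c_X(σ),
--   ‖α_v‖ = A_v / (C(d,i) D)         with A_v = Σ_{τ ∈ X_v(i-1), α_v τ = 1} c_{X_v}(τ).
-- The link X_v is in bijection τ ↦ τ ∪ {v} with the faces of X containing v, and this
-- bijection preserves the number of top cells above a face.  Hence two double countings
-- over the incidences (v, σ) with v ∈ σ give
--   Σ_v A_v = (i+1) A     and     N D = (d+1) T,
-- and the identity follows from the absorption law (i+1) C(d+1,i+1) = (d+1) C(d,i).
-- Purity and the empty face provide a top cell, hence a vertex, so T, N and D are positive.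

open import Defs

module FiniteSums where

  open import Data.Nat using (ℕ; suc; _+_; _*_; _≤_; z≤n)
  open import Data.Nat.Properties
  open import Data.Bool using (Bool; true; false; _∧_)
  import Data.Bool as Bool
  open import Data.List using (List; []; _∷_; map; length; _++_; allFin)
  import Data.List.Properties as List
  open import Data.Fin using (Fin; zero; suc)
  import Data.Fin as Fin
  open import Data.Fin.Subset using (Subset; inside; outside)
  open import Data.Vec using ([]; _∷_)
  open import Data.Vec.Properties using (≡-dec)
  open import Function.Bundles using (mk⇔)
  open import Relation.Binary.Definitions using (DecidableEquality)
  open import Relation.Binary.PropositionalEquality
  open import Relation.Nullary.Decidable using (does; yes; no; does-⇔)
  open import Algebra.Properties.CommutativeSemigroup +-commutativeSemigroup
    using () renaming (interchange to +-interchange)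

  𝟙 : Bool → ℕ
  𝟙 true  = 1
  𝟙 false = 0

  𝟙-∧ : ∀ a b → 𝟙 (a ∧ b) ≡ 𝟙 a * 𝟙 b
  𝟙-∧ true  b = sym (+-identityʳ (𝟙 b))
  𝟙-∧ false b = refl

  𝟙-guard : ∀ b {x y} → (b ≡ true → x ≡ y) → 𝟙 b * x ≡ 𝟙 b * y
  𝟙-guard true  x≡y = cong (_+ 0) (x≡y refl)
  𝟙-guard false _   = refl

  ∑ : {A : Set} → List A → (A → ℕ) → ℕ
  ∑ []       f = 0
  ∑ (x ∷ xs) f = f x + ∑ xs f

  syntax ∑ L (λ x → e) = ∑[ x ← L ] e

  module _ {A : Set} where

    ∑-cong : (L : List A) {f g : A → ℕ} → (∀ x → f x ≡ g x) → ∑ L f ≡ ∑ L g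
    ∑-cong []      f≗g = refl
    ∑-cong (x ∷ L) f≗g = cong₂ _+_ (f≗g x) (∑-cong L f≗g)

    ∑-zero : (L : List A) → ∑[ x ← L ] 0 ≡ 0
    ∑-zero []      = refl
    ∑-zero (x ∷ L) = ∑-zero L

    ∑-+ : (L : List A) (f g : A → ℕ) → ∑[ x ← L ] (f x + g x) ≡ ∑ L f + ∑ L g
    ∑-+ []      f g = refl
    ∑-+ (x ∷ L) f g = trans (cong (f x + g x +_) (∑-+ L f g)) (+-interchange (f x) (g x) (∑ L f) (∑ L g))

    ∑-*ˡ : (L : List A) (c : ℕ) (f : A → ℕ) → ∑[ x ← L ] (c * f x) ≡ c * ∑ L f
    ∑-*ˡ []      c f = sym (*-zeroʳ c)
    ∑-*ˡ (x ∷ L) c f = trans (cong (c * f x +_) (∑-*ˡ L c f)) (sym (*-distribˡ-+ c (f x) (∑ L f)))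

    ∑-*ʳ : (L : List A) (c : ℕ) (f : A → ℕ) → ∑[ x ← L ] (f x * c) ≡ ∑ L f * c
    ∑-*ʳ L c f = trans (∑-cong L (λ x → *-comm (f x) c)) (trans (∑-*ˡ L c f) (*-comm c (∑ L f)))

    ∑-++ : (L M : List A) (f : A → ℕ) → ∑ (L ++ M) f ≡ ∑ L f + ∑ M f
    ∑-++ []      M f = refl
    ∑-++ (x ∷ L) M f = trans (cong (f x +_) (∑-++ L M f)) (sym (+-assoc (f x) (∑ L f) (∑ M f)))

    ∑-mono : (L : List A) {f g : A → ℕ} → (∀ x → f x ≤ g x) → ∑ L f ≤ ∑ L g
    ∑-mono []      f≤g = z≤n
    ∑-mono (x ∷ L) f≤g = +-mono-≤ (f≤g x) (∑-mono L f≤g)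

    ∑-const : (L : List A) (c : ℕ) → ∑[ x ← L ] c ≡ length L * c
    ∑-const []      c = refl
    ∑-const (x ∷ L) c = cong (c +_) (∑-const L c)

    length-as-∑ : (L : List A) → length L ≡ ∑[ x ← L ] 1
    length-as-∑ []      = refl
    length-as-∑ (x ∷ L) = cong suc (length-as-∑ L)

    ∑-select : (p : A → Bool) (L : List A) (f : A → ℕ) → ∑ (select p L) f ≡ ∑[ x ← L ] (𝟙 (p x) * f x)
    ∑-select p []      f = refl
    ∑-select p (x ∷ L) f with p x
    ... | true  = cong₂ _+_ (sym (+-identityʳ (f x))) (∑-select p L f)
    ... | false = ∑-select p L f

    select-select : (p q : A → Bool) (L : List A) → select p (select q L) ≡ select (λ x → q x ∧ p x) L
    select-select p q [] = refl
    select-select p q (x ∷ L) with q x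
    ... | false = select-select p q L
    ... | true with p x
    ...   | true  = cong (x ∷_) (select-select p q L)
    ...   | false = select-select p q L

  module _ {A B : Set} where

    ∑-map : (g : A → B) (L : List A) (f : B → ℕ) → ∑ (map g L) f ≡ ∑[ x ← L ] f (g x)
    ∑-map g []      f = refl
    ∑-map g (x ∷ L) f = cong (f (g x) +_) (∑-map g L f)

    ∑-swap : (L : List A) (M : List B) (F : A → B → ℕ) →
      ∑[ x ← L ] ∑[ y ← M ] F x y ≡ ∑[ y ← M ] ∑[ x ← L ] F x y
    ∑-swap []      M F = sym (∑-zero M)
    ∑-swap (x ∷ L) M F = trans (cong (∑ M (F x) +_) (∑-swap L M F)) (sym (∑-+ M (F x) (λ y → ∑[ x ← L ] F x y)))

  module Enumeration {A : Set} (_≟_ : DecidableEquality A) (E : List A)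
    (once : ∀ z → ∑[ x ← E ] 𝟙 (does (x ≟ z)) ≡ 1) where

    ∑-pick : (f : A → ℕ) (z : A) → ∑[ y ← E ] (𝟙 (does (y ≟ z)) * f y) ≡ f z
    ∑-pick f z = begin
      ∑[ y ← E ] (𝟙 (does (y ≟ z)) * f y) ≡⟨ ∑-cong E only-z ⟩
      ∑[ y ← E ] (𝟙 (does (y ≟ z)) * f z) ≡⟨ ∑-*ʳ E (f z) (λ y → 𝟙 (does (y ≟ z))) ⟩
      ∑[ y ← E ] 𝟙 (does (y ≟ z)) * f z   ≡⟨ cong (_* f z) (once z) ⟩
      1 * f z                              ≡⟨ *-identityˡ (f z) ⟩
      f z                                  ∎
      where
      open ≡-Reasoning
      only-z : ∀ y → 𝟙 (does (y ≟ z)) * f y ≡ 𝟙 (does (y ≟ z)) * f z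
      only-z y with y ≟ z
      ... | yes refl = refl
      ... | no _     = refl

    term≤∑ : (f : A → ℕ) (z : A) → f z ≤ ∑ E f
    term≤∑ f z = subst (_≤ ∑ E f) (∑-pick f z) (∑-mono E below)
      where
      below : ∀ y → 𝟙 (does (y ≟ z)) * f y ≤ f y
      below y with y ≟ z
      ... | yes _ = ≤-reflexive (+-identityʳ (f y))
      ... | no _  = z≤n

    -- Reindexing along a bijection g (with inverse h): expand each f (g x) by ∑-pick,
    -- swap the sums and use that y = g x exactly when x = h y.
    ∑-bijection : (g h : A → A) → (∀ x → h (g x) ≡ x) → (∀ y → g (h y) ≡ y) →
      (f : A → ℕ) → ∑[ x ← E ] f (g x) ≡ ∑ E f
    ∑-bijection g h hg gh f = begin
      ∑[ x ← E ] f (g x)                                ≡⟨ ∑-cong E (λ x → sym (∑-pick f (g x))) ⟩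
      ∑[ x ← E ] ∑[ y ← E ] (𝟙 (does (y ≟ g x)) * f y)  ≡⟨ ∑-swap E E _ ⟩
      ∑[ y ← E ] ∑[ x ← E ] (𝟙 (does (y ≟ g x)) * f y)  ≡⟨ ∑-cong E (λ y → ∑-cong E (λ x →
                                                             cong (λ b → 𝟙 b * f y) (transpose x y))) ⟩
      ∑[ y ← E ] ∑[ x ← E ] (𝟙 (does (x ≟ h y)) * f y)  ≡⟨ ∑-cong E (λ y → ∑-pick (λ _ → f y) (h y)) ⟩
      ∑ E f                                             ∎
      where
      open ≡-Reasoning
      transpose : ∀ x y → does (y ≟ g x) ≡ does (x ≟ h y)
      transpose x y = does-⇔ (mk⇔ (λ y≡gx → trans (sym (hg x)) (cong h (sym y≡gx)))
                                  (λ x≡hy → trans (sym (gh y)) (cong g (sym x≡hy))))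
                             (y ≟ g x) (x ≟ h y)

  ∑-allFin-suc : ∀ {n} (f : Fin (suc n) → ℕ) → ∑ (allFin (suc n)) f ≡ f zero + ∑[ j ← allFin n ] f (suc j)
  ∑-allFin-suc {n} f = cong (f zero +_)
    (trans (cong (λ L → ∑ L f) (sym (List.map-tabulate (λ j → j) suc))) (∑-map suc (allFin n) f))

  allFin-once : ∀ {n} (z : Fin n) → ∑[ x ← allFin n ] 𝟙 (does (x Fin.≟ z)) ≡ 1
  allFin-once {suc n} zero    = trans (∑-allFin-suc {n} (λ x → 𝟙 (does (x Fin.≟ zero)))) (cong suc (∑-zero (allFin n)))
  allFin-once {suc n} (suc z) = trans (∑-allFin-suc {n} (λ x → 𝟙 (does (x Fin.≟ suc z)))) (allFin-once z)

  _≟ₛ_ : ∀ {n} → DecidableEquality (Subset n)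
  _≟ₛ_ = ≡-dec Bool._≟_

  ∑-allSubsets-suc : ∀ {n} (f : Subset (suc n) → ℕ) → ∑ (allSubsets (suc n)) f ≡
    ∑[ τ ← allSubsets n ] f (outside ∷ τ) + ∑[ τ ← allSubsets n ] f (inside ∷ τ)
  ∑-allSubsets-suc {n} f = trans (∑-++ (map (outside ∷_) (allSubsets n)) _ f)
    (cong₂ _+_ (∑-map (outside ∷_) (allSubsets n) f) (∑-map (inside ∷_) (allSubsets n) f))

  allSubsets-once : ∀ {n} (z : Subset n) → ∑[ x ← allSubsets n ] 𝟙 (does (x ≟ₛ z)) ≡ 1
  allSubsets-once [] = refl
  allSubsets-once {suc n} (outside ∷ z) = begin
    ∑[ x ← allSubsets (suc n) ] 𝟙 (does (x ≟ₛ (outside ∷ z)))         ≡⟨ ∑-allSubsets-suc {n} _ ⟩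
    ∑[ τ ← allSubsets n ] 𝟙 (does (τ ≟ₛ z)) + ∑[ τ ← allSubsets n ] 0 ≡⟨ cong₂ _+_ (allSubsets-once z) (∑-zero (allSubsets n)) ⟩
    1                                                                  ∎
    where open ≡-Reasoning
  allSubsets-once {suc n} (inside ∷ z) = begin
    ∑[ x ← allSubsets (suc n) ] 𝟙 (does (x ≟ₛ (inside ∷ z)))         ≡⟨ ∑-allSubsets-suc {n} _ ⟩
    ∑[ τ ← allSubsets n ] 0 + ∑[ τ ← allSubsets n ] 𝟙 (does (τ ≟ₛ z)) ≡⟨ cong₂ _+_ (∑-zero (allSubsets n)) (allSubsets-once z) ⟩
    1                                                                  ∎
    where open ≡-Reasoning

  module FinEnumeration {n : ℕ} = Enumeration (Fin._≟_ {n}) (allFin n) allFin-once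
  module SubsetEnumeration {n : ℕ} = Enumeration (_≟ₛ_ {n}) (allSubsets n) allSubsets-once

module SubsetLemmas where

  open FiniteSums
  open import Data.Nat using (ℕ; suc; _+_; _*_)
  open import Data.Nat.Properties using (+-identityʳ; +-comm)
  open import Data.Bool using (true; not)
  open import Data.Empty using (⊥-elim)
  open import Data.List using (allFin)
  open import Data.Fin using (Fin; zero; suc)
  open import Data.Fin.Subset using (Subset; _∈_; _∉_; _⊆_; ∣_∣; ⁅_⁆; _∪_; ⊥; inside; outside)
  open import Data.Fin.Subset.Properties using (_⊆?_; x∈⁅x⁆; x∈⁅y⁆⇒x≡y; x∈p∪q⁺; x∈p∪q⁻; ∪-identityʳ)
  open import Data.Fin.Permutation using (Permutation′; _⟨$⟩ˡ_; _⟨$⟩ʳ_; inverseˡ; inverseʳ)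
  open import Data.Vec using ([]; _∷_; lookup; tabulate; here; there)
  open import Data.Vec.Properties using ([]=⇒lookup; lookup⇒[]=; lookup∘tabulate; tabulate∘lookup; tabulate-cong)
  open import Data.Product using (Σ; _,_)
  open import Data.Sum using (inj₁; inj₂)
  open import Function using (_∘_)
  open import Function.Bundles using (_⇔_; mk⇔)
  open import Relation.Binary.PropositionalEquality
  open import Relation.Nullary.Decidable using (Dec; ⌊_⌋; isYes≗does; does-⇔)

  ∈⇒lookup : ∀ {n} {p : Subset n} {x} → x ∈ p → lookup p x ≡ true
  ∈⇒lookup = []=⇒lookup

  lookup⇒∈ : ∀ {n} {p : Subset n} {x} → lookup p x ≡ true → x ∈ p
  lookup⇒∈ {p = p} {x} = lookup⇒[]= x p

  not-lookup⇒∉ : ∀ {n} {p : Subset n} {x} → not (lookup p x) ≡ true → x ∉ p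
  not-lookup⇒∉ x∉p x∈p with () ← trans (sym (cong not (∈⇒lookup x∈p))) x∉p

  ⌊⌋-⇔ : ∀ {A B : Set} → A ⇔ B → (a? : Dec A) (b? : Dec B) → ⌊ a? ⌋ ≡ ⌊ b? ⌋
  ⌊⌋-⇔ A⇔B a? b? = trans (isYes≗does a?) (trans (does-⇔ A⇔B a? b?) (sym (isYes≗does b?)))

  size-as-∑ : ∀ {n} (p : Subset n) → ∣ p ∣ ≡ ∑[ j ← allFin n ] 𝟙 (lookup p j)
  size-as-∑ []            = refl
  size-as-∑ (inside ∷ p)  = trans (cong suc (size-as-∑ p)) (sym (∑-allFin-suc (λ j → 𝟙 (lookup (inside ∷ p) j))))
  size-as-∑ (outside ∷ p) = trans (size-as-∑ p) (sym (∑-allFin-suc (λ j → 𝟙 (lookup (outside ∷ p) j))))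

  member-of-nonempty : ∀ {n k} (τ : Subset n) → ∣ τ ∣ ≡ suc k → Σ (Fin n) (λ v → lookup τ v ≡ true)
  member-of-nonempty (inside ∷ τ)  _       = zero , refl
  member-of-nonempty (outside ∷ τ) ∣τ∣≡1+k with member-of-nonempty τ ∣τ∣≡1+k
  ... | v , v∈τ = suc v , v∈τ

  ⁅⁆⊆⇔∈ : ∀ {n} (σ : Subset n) v → ⁅ v ⁆ ⊆ σ ⇔ v ∈ σ
  ⁅⁆⊆⇔∈ σ v = mk⇔ (λ v⊆σ → v⊆σ (x∈⁅x⁆ v)) (λ v∈σ {x} x∈v → subst (_∈ σ) (sym (x∈⁅y⁆⇒x≡y v x∈v)) v∈σ)

  ∈⁅⁆∪ : ∀ {n} (τ : Subset n) v → v ∈ τ ∪ ⁅ v ⁆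
  ∈⁅⁆∪ τ v = x∈p∪q⁺ (inj₂ (x∈⁅x⁆ v))

  size-insert : ∀ {n} (τ : Subset n) v → v ∉ τ → ∣ τ ∪ ⁅ v ⁆ ∣ ≡ suc ∣ τ ∣
  size-insert (outside ∷ τ) zero    _   = cong (λ ρ → suc ∣ ρ ∣) (∪-identityʳ τ)
  size-insert (inside ∷ τ)  zero    v∉τ = ⊥-elim (v∉τ here)
  size-insert (inside ∷ τ)  (suc v) v∉τ = cong suc (size-insert τ v (v∉τ ∘ there))
  size-insert (outside ∷ τ) (suc v) v∉τ = size-insert τ v (v∉τ ∘ there)

  ⊆-insert : ∀ {n} (τ ρ : Subset n) v → v ∉ τ → ⌊ τ ⊆? ρ ⌋ ≡ ⌊ τ ∪ ⁅ v ⁆ ⊆? ρ ∪ ⁅ v ⁆ ⌋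
  ⊆-insert τ ρ v v∉τ = ⌊⌋-⇔ (mk⇔ extend shrink) (τ ⊆? ρ) (τ ∪ ⁅ v ⁆ ⊆? ρ ∪ ⁅ v ⁆)
    where
    extend : τ ⊆ ρ → τ ∪ ⁅ v ⁆ ⊆ ρ ∪ ⁅ v ⁆
    extend τ⊆ρ x∈τ∪v with x∈p∪q⁻ τ ⁅ v ⁆ x∈τ∪v
    ... | inj₁ x∈τ = x∈p∪q⁺ (inj₁ (τ⊆ρ x∈τ))
    ... | inj₂ x∈v = x∈p∪q⁺ (inj₂ x∈v)
    shrink : τ ∪ ⁅ v ⁆ ⊆ ρ ∪ ⁅ v ⁆ → τ ⊆ ρ
    shrink τv⊆ρv {x} x∈τ with x∈p∪q⁻ ρ ⁅ v ⁆ (τv⊆ρv (x∈p∪q⁺ (inj₁ x∈τ)))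
    ... | inj₁ x∈ρ = x∈ρ
    ... | inj₂ x∈v = ⊥-elim (v∉τ (subst (_∈ τ) (x∈⁅y⁆⇒x≡y v x∈v) x∈τ))

  -- τ ↦ τ ∪ {v} is a bijection from the subsets avoiding v onto those containing v.
  ∑-insert : ∀ {n} (v : Fin n) (G : Subset n → ℕ) →
    ∑[ τ ← allSubsets n ] (𝟙 (not (lookup τ v)) * G (τ ∪ ⁅ v ⁆)) ≡ ∑[ σ ← allSubsets n ] (𝟙 (lookup σ v) * G σ)
  ∑-insert {suc n} zero G = begin
    ∑[ τ ← allSubsets (suc n) ] (𝟙 (not (lookup τ zero)) * G (τ ∪ ⁅ zero ⁆))
      ≡⟨ ∑-allSubsets-suc {n} _ ⟩
    ∑[ τ ← S ] (G (inside ∷ (τ ∪ ⊥)) + 0) + ∑[ τ ← S ] 0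
      ≡⟨ cong₂ _+_ (∑-cong S (λ τ → trans (+-identityʳ _) (cong (λ ρ → G (inside ∷ ρ)) (∪-identityʳ τ)))) (∑-zero S) ⟩
    ∑[ τ ← S ] G (inside ∷ τ) + 0
      ≡⟨ +-comm _ 0 ⟩
    0 + ∑[ τ ← S ] G (inside ∷ τ)
      ≡⟨ cong₂ _+_ (sym (∑-zero S)) (∑-cong S (λ τ → sym (+-identityʳ (G (inside ∷ τ))))) ⟩
    ∑[ τ ← S ] 0 + ∑[ τ ← S ] (G (inside ∷ τ) + 0)
      ≡⟨ ∑-allSubsets-suc {n} _ ⟨
    ∑[ σ ← allSubsets (suc n) ] (𝟙 (lookup σ zero) * G σ) ∎
    where
    open ≡-Reasoning
    S = allSubsets n
  ∑-insert {suc n} (suc v) G = begin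
    ∑[ τ ← allSubsets (suc n) ] (𝟙 (not (lookup τ (suc v))) * G (τ ∪ ⁅ suc v ⁆))
      ≡⟨ ∑-allSubsets-suc {n} _ ⟩
    _ ≡⟨ cong₂ _+_ (∑-insert v (λ σ → G (outside ∷ σ))) (∑-insert v (λ σ → G (inside ∷ σ))) ⟩
    _ ≡⟨ ∑-allSubsets-suc {n} _ ⟨
    ∑[ σ ← allSubsets (suc n) ] (𝟙 (lookup σ (suc v)) * G σ) ∎
    where open ≡-Reasoning

  preimage : ∀ {n} → Permutation′ n → Subset n → Subset n
  preimage π σ = tabulate (λ j → lookup σ (π ⟨$⟩ʳ j))

  image-preimage : ∀ {n} (π : Permutation′ n) (σ : Subset n) → image π (preimage π σ) ≡ σ
  image-preimage π σ = trans
    (tabulate-cong (λ j → trans (lookup∘tabulate _ (π ⟨$⟩ˡ j)) (cong (lookup σ) (inverseʳ π))))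
    (tabulate∘lookup σ)

  preimage-image : ∀ {n} (π : Permutation′ n) (σ : Subset n) → preimage π (image π σ) ≡ σ
  preimage-image π σ = trans
    (tabulate-cong (λ j → trans (lookup∘tabulate _ (π ⟨$⟩ʳ j)) (cong (lookup σ) (inverseˡ π))))
    (tabulate∘lookup σ)

  size-image : ∀ {n} (π : Permutation′ n) (σ : Subset n) → ∣ image π σ ∣ ≡ ∣ σ ∣
  size-image {n} π σ = begin
    ∣ image π σ ∣                               ≡⟨ size-as-∑ (image π σ) ⟩
    ∑[ j ← allFin n ] 𝟙 (lookup (image π σ) j)  ≡⟨ ∑-cong (allFin n) (λ j → cong 𝟙 (lookup∘tabulate _ j)) ⟩
    ∑[ j ← allFin n ] 𝟙 (lookup σ (π ⟨$⟩ˡ j))   ≡⟨ FinEnumeration.∑-bijection (π ⟨$⟩ˡ_) (π ⟨$⟩ʳ_)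
                                                     (λ _ → inverseʳ π) (λ _ → inverseˡ π) _ ⟩
    ∑[ j ← allFin n ] 𝟙 (lookup σ j)            ≡⟨ size-as-∑ σ ⟨
    ∣ σ ∣                                       ∎
    where open ≡-Reasoning

  ∑-image : ∀ {n} (π : Permutation′ n) (f : Subset n → ℕ) → ∑[ σ ← allSubsets n ] f (image π σ) ≡ ∑ (allSubsets n) f
  ∑-image π = SubsetEnumeration.∑-bijection (image π) (preimage π) (preimage-image π) (image-preimage π)

module Fractions where

  open FiniteSums using (∑; 𝟙)
  open import Data.Nat using (ℕ; zero; suc; _+_; _*_; _≤_; _<_; z≤n; s≤s; NonZero)
  open import Data.Nat.Properties
  open import Data.Nat.Combinatorics using (_C_; nC1≡n; nCk+nC[k+1]≡[n+1]C[k+1]; k>n⇒nCk≡0)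
  open import Data.Nat.Solver using (module +-*-Solver)
  open import Data.Bool using (Bool; true; false)
  open import Data.List using (List; []; _∷_; map)
  open import Data.Integer as ℤ using (+_)
  import Data.Integer.Properties as ℤ
  open import Data.Rational using (ℚ; 0ℚ; fromℚᵘ) renaming (_+_ to _+ℚ_; _*_ to _*ℚ_)
  import Data.Rational.Properties as ℚ
  open import Data.Rational.Unnormalised as ℚᵘ using (mkℚᵘ; *≡*)
  import Data.Rational.Unnormalised.Properties as ℚᵘ
  open import Relation.Binary.PropositionalEquality

  fromℚᵘ-+ : ∀ p q → fromℚᵘ (p ℚᵘ.+ q) ≡ fromℚᵘ p +ℚ fromℚᵘ q
  fromℚᵘ-+ p q = ℚ.toℚᵘ-injective (ℚᵘ.≃-trans (ℚ.toℚᵘ-fromℚᵘ (p ℚᵘ.+ q))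
    (ℚᵘ.≃-trans (ℚᵘ.+-cong (ℚᵘ.≃-sym (ℚ.toℚᵘ-fromℚᵘ p)) (ℚᵘ.≃-sym (ℚ.toℚᵘ-fromℚᵘ q)))
      (ℚᵘ.≃-sym (ℚ.toℚᵘ-homo-+ (fromℚᵘ p) (fromℚᵘ q)))))

  fromℚᵘ-* : ∀ p q → fromℚᵘ (p ℚᵘ.* q) ≡ fromℚᵘ p *ℚ fromℚᵘ q
  fromℚᵘ-* p q = ℚ.toℚᵘ-injective (ℚᵘ.≃-trans (ℚ.toℚᵘ-fromℚᵘ (p ℚᵘ.* q))
    (ℚᵘ.≃-trans (ℚᵘ.*-cong (ℚᵘ.≃-sym (ℚ.toℚᵘ-fromℚᵘ p)) (ℚᵘ.≃-sym (ℚ.toℚᵘ-fromℚᵘ q)))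
      (ℚᵘ.≃-sym (ℚ.toℚᵘ-homo-* (fromℚᵘ p) (fromℚᵘ q)))))

  -- For q ≠ 0, divℚ a q is the normalisation of the unnormalised fraction a / q; the
  -- lemmas below hold for q = 0 as well, where divℚ a 0 = 0.
  divℚ-cross : ∀ a b p q .{{_ : NonZero p}} .{{_ : NonZero q}} → a * q ≡ b * p → divℚ a p ≡ divℚ b q
  divℚ-cross a b (suc k) (suc m) cross = ℚ.fromℚᵘ-cong {mkℚᵘ (+ a) k} {mkℚᵘ (+ b) m} (*≡* (begin
    + a ℤ.* + suc m  ≡⟨ ℤ.pos-* a (suc m) ⟨
    + (a * suc m)    ≡⟨ cong +_ cross ⟩
    + (b * suc k)    ≡⟨ ℤ.pos-* b (suc k) ⟩
    + b ℤ.* + suc k  ∎))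
    where open ≡-Reasoning

  divℚ-zero : ∀ q → divℚ 0 q ≡ 0ℚ
  divℚ-zero zero    = refl
  divℚ-zero (suc k) = divℚ-cross 0 0 (suc k) 1 refl

  divℚ-+ : ∀ a b q → divℚ a q +ℚ divℚ b q ≡ divℚ (a + b) q
  divℚ-+ a b zero    = ℚ.+-identityʳ 0ℚ
  divℚ-+ a b (suc k) = trans (sym (fromℚᵘ-+ (mkℚᵘ (+ a) k) (mkℚᵘ (+ b) k)))
    (ℚ.fromℚᵘ-cong {mkℚᵘ (+ a) k ℚᵘ.+ mkℚᵘ (+ b) k} {mkℚᵘ (+ (a + b)) k} (*≡* (begin
      (+ a ℤ.* + suc k ℤ.+ + b ℤ.* + suc k) ℤ.* + suc k  ≡⟨ cong (ℤ._* + suc k) (ℤ.*-distribʳ-+ (+ suc k) (+ a) (+ b)) ⟨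
      (+ a ℤ.+ + b) ℤ.* + suc k ℤ.* + suc k              ≡⟨ ℤ.*-assoc (+ (a + b)) (+ suc k) (+ suc k) ⟩
      + (a + b) ℤ.* (+ suc k ℤ.* + suc k)                ∎)))
    where open ≡-Reasoning

  divℚ-* : ∀ a b p q → divℚ a p *ℚ divℚ b q ≡ divℚ (a * b) (p * q)
  divℚ-* a b zero    q       = ℚ.*-zeroˡ (divℚ b q)
  divℚ-* a b (suc k) zero    = trans (ℚ.*-zeroʳ (divℚ a (suc k))) (cong (divℚ (a * b)) (sym (*-zeroʳ k)))
  divℚ-* a b (suc k) (suc m) = trans (sym (fromℚᵘ-* (mkℚᵘ (+ a) k) (mkℚᵘ (+ b) m)))
    (ℚ.fromℚᵘ-cong {mkℚᵘ (+ a) k ℚᵘ.* mkℚᵘ (+ b) m} {mkℚᵘ (+ (a * b)) (m + k * suc m)}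
      (*≡* (cong (ℤ._* + (suc k * suc m)) (sym (ℤ.pos-* a b)))))

  sum-of-fractions : {A : Set} (p : A → Bool) (g : A → ℚ) (f : A → ℕ) (q : ℕ) (L : List A) →
    (∀ x → p x ≡ true → g x ≡ divℚ (f x) q) →
    sumℚ (map g (select p L)) ≡ divℚ (∑[ x ← L ] (𝟙 (p x) * f x)) q
  sum-of-fractions p g f q []      _  = sym (divℚ-zero q)
  sum-of-fractions p g f q (x ∷ L) gx with p x in px
  ... | true  = trans (cong₂ _+ℚ_ (gx x px) (sum-of-fractions p g f q L gx))
                      (trans (divℚ-+ (f x) _ q) (cong (λ a → divℚ (a + ∑[ y ← L ] (𝟙 (p y) * f y)) q) (sym (+-identityʳ (f x)))))
  ... | false = sum-of-fractions p g f q L gx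

  binomial-absorption : ∀ n k → suc k * (suc n C suc k) ≡ suc n * (n C k)
  binomial-absorption zero zero = refl
  binomial-absorption zero (suc k)
    rewrite k>n⇒nCk≡0 {1} {suc (suc k)} (s≤s (s≤s z≤n)) | k>n⇒nCk≡0 {0} {suc k} (s≤s z≤n) = *-zeroʳ (suc (suc k))
  binomial-absorption (suc m) zero rewrite nC1≡n (suc (suc m)) = trans (+-identityʳ _) (sym (*-identityʳ _))
  binomial-absorption (suc m) (suc j) = begin
    suc (suc j) * (suc (suc m) C suc (suc j))
      ≡⟨ cong (suc (suc j) *_) (nCk+nC[k+1]≡[n+1]C[k+1] (suc m) (suc j)) ⟨
    suc (suc j) * (A + B)
      ≡⟨ solve 3 (λ j A B → (con 2 :+ j) :* (A :+ B) := A :+ (con 1 :+ j) :* A :+ (con 2 :+ j) :* B) refl j A B ⟩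
    A + suc j * A + suc (suc j) * B
      ≡⟨ cong₂ (λ x y → A + x + y) (binomial-absorption m j) (binomial-absorption m (suc j)) ⟩
    A + suc m * (m C j) + suc m * (m C suc j)
      ≡⟨ solve 4 (λ A m x y → A :+ (con 1 :+ m) :* x :+ (con 1 :+ m) :* y := A :+ (con 1 :+ m) :* (x :+ y))
           refl A m (m C j) (m C suc j) ⟩
    A + suc m * (m C j + m C suc j)
      ≡⟨ cong (λ z → A + suc m * z) (nCk+nC[k+1]≡[n+1]C[k+1] m j) ⟩
    suc (suc m) * A ∎
    where
    open ≡-Reasoning
    open +-*-Solver
    A = suc m C suc j
    B = suc m C suc (suc j)

  binomial-positive : ∀ {n k} → k ≤ n → 0 < n C k
  binomial-positive {n}     {zero}  _         = s≤s z≤n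
  binomial-positive {suc n} {suc k} (s≤s k≤n) = subst (0 <_) (nCk+nC[k+1]≡[n+1]C[k+1] n k)
    (≤-trans (binomial-positive k≤n) (m≤m+n (n C k) (n C suc k)))

  -- Cross-multiplied form of  A / (C(d+1,i+1) T) = (1/N) · B / (C(d,i) D),  given the two
  -- double countings B = (i+1) A and N D = (d+1) T.
  averaging-arithmetic : ∀ i d A B N D T → B ≡ suc i * A → N * D ≡ suc d * T →
    A * (N * ((d C i) * D)) ≡ 1 * B * ((suc d C suc i) * T)
  averaging-arithmetic i d A B N D T B≡[i+1]A ND≡[d+1]T = begin
    A * (N * (c * D))          ≡⟨ solve 4 (λ A c N D → A :* (N :* (c :* D)) := A :* c :* (N :* D)) refl A c N D ⟩
    A * c * (N * D)            ≡⟨ cong (A * c *_) ND≡[d+1]T ⟩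
    A * c * (suc d * T)        ≡⟨ solve 4 (λ A c s T → A :* c :* (s :* T) := A :* (s :* c) :* T) refl A c (suc d) T ⟩
    A * (suc d * c) * T        ≡⟨ cong (λ z → A * z * T) (binomial-absorption d i) ⟨
    A * (suc i * c′) * T       ≡⟨ solve 4 (λ A s c′ T → A :* (s :* c′) :* T := con 1 :* (s :* A) :* (c′ :* T))
                                    refl A (suc i) c′ T ⟩
    1 * (suc i * A) * (c′ * T) ≡⟨ cong (λ b → 1 * b * (c′ * T)) B≡[i+1]A ⟨
    1 * B * (c′ * T)           ∎
    where
    open ≡-Reasoning
    open +-*-Solver
    c  = d C i
    c′ = suc d C suc i

module Complexes where

  open FiniteSums
  open SubsetLemmas
  open Fractions
  open import Data.Nat using (ℕ; suc; _+_; _*_; _≡ᵇ_; _≤_; s≤s; NonZero; >-nonZero)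
  open import Data.Nat.Properties
  open import Data.Nat.Combinatorics using (_C_)
  open import Data.Bool using (Bool; true; false; _∧_; not)
  open import Data.Bool.Properties using (T-≡; ∧-conicalˡ; ∧-conicalʳ)
  open import Data.List using (List; map; length; allFin)
  open import Data.Rational using () renaming (_*_ to _*ℚ_)
  open import Data.Fin using (Fin)
  open import Data.Fin.Subset using (Subset; _∉_; ∣_∣; ⁅_⁆; _∪_; ⊥)
  open import Data.Fin.Subset.Properties using (_⊆?_)
  open import Data.Vec using (lookup)
  open import Data.Product using (_,_; proj₁; proj₂)
  open import Function.Bundles using (Equivalence)
  open import Relation.Binary.PropositionalEquality
  open import Relation.Nullary.Decidable using (⌊_⌋; yes; no)

  module _ {n : ℕ} where

    𝒮 : List (Subset n)
    𝒮 = allSubsets n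

    isCell : Faces n → ℕ → Subset n → Bool
    isCell Y k σ = Y σ ∧ (∣ σ ∣ ≡ᵇ k)

    cell-face : ∀ (Y : Faces n) k σ → isCell Y k σ ≡ true → Y σ ≡ true
    cell-face Y k σ = ∧-conicalˡ (Y σ) (∣ σ ∣ ≡ᵇ k)

    cell-size : ∀ (Y : Faces n) k σ → isCell Y k σ ≡ true → ∣ σ ∣ ≡ k
    cell-size Y k σ cellσ = ≡ᵇ⇒≡ ∣ σ ∣ k (Equivalence.from T-≡ (∧-conicalʳ (Y σ) (∣ σ ∣ ≡ᵇ k) cellσ))

    cellCount-as-∑ : (Y : Faces n) (k : ℕ) → length (cells Y k) ≡ ∑[ σ ← 𝒮 ] (𝟙 (isCell Y k σ) * 1)
    cellCount-as-∑ Y k = trans (length-as-∑ (cells Y k)) (∑-select (isCell Y k) 𝒮 (λ _ → 1))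

    count-as-∑ : (Y : Faces n) (k : ℕ) (τ : Subset n) →
      count Y k τ ≡ ∑[ σ ← 𝒮 ] (𝟙 (isCell Y k σ) * 𝟙 ⌊ τ ⊆? σ ⌋)
    count-as-∑ Y k τ = begin
      length (select (λ σ → ⌊ τ ⊆? σ ⌋) (cells Y k))            ≡⟨ cong length (select-select _ (isCell Y k) 𝒮) ⟩
      length (select τ-cell 𝒮)                                  ≡⟨ length-as-∑ (select τ-cell 𝒮) ⟩
      ∑ (select τ-cell 𝒮) (λ _ → 1)                             ≡⟨ ∑-select τ-cell 𝒮 (λ _ → 1) ⟩
      ∑[ σ ← 𝒮 ] (𝟙 (τ-cell σ) * 1)                             ≡⟨ ∑-cong 𝒮 (λ σ → trans (*-identityʳ _) (𝟙-∧ (isCell Y k σ) _)) ⟩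
      ∑[ σ ← 𝒮 ] (𝟙 (isCell Y k σ) * 𝟙 ⌊ τ ⊆? σ ⌋)             ∎
      where
      open ≡-Reasoning
      τ-cell : Subset n → Bool
      τ-cell σ = isCell Y k σ ∧ ⌊ τ ⊆? σ ⌋

    weightedCount : Faces n → ℕ → ℕ → (Subset n → Bool) → ℕ
    weightedCount Y top k α = ∑[ σ ← 𝒮 ] (𝟙 (isCell Y k σ) * (𝟙 (α σ) * count Y top σ))

    norm-as-fraction : (Y : Faces n) (top k : ℕ) (α : Subset n → Bool) →
      norm Y top k α ≡ divℚ (weightedCount Y top k α) ((top C k) * length (cells Y top))
    norm-as-fraction Y top k α = begin
      sumℚ (map (weight Y top) (select α (cells Y k)))
        ≡⟨ cong (λ L → sumℚ (map (weight Y top) L)) (select-select α (isCell Y k) 𝒮) ⟩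
      sumℚ (map (weight Y top) (select (λ σ → isCell Y k σ ∧ α σ) 𝒮))
        ≡⟨ sum-of-fractions _ (weight Y top) (count Y top) q 𝒮 weight-of-cell ⟩
      divℚ (∑[ σ ← 𝒮 ] (𝟙 (isCell Y k σ ∧ α σ) * count Y top σ)) q
        ≡⟨ cong (λ a → divℚ a q) (∑-cong 𝒮 (λ σ → trans (cong (_* count Y top σ) (𝟙-∧ (isCell Y k σ) (α σ)))
                                                        (*-assoc (𝟙 (isCell Y k σ)) (𝟙 (α σ)) (count Y top σ)))) ⟩
      divℚ (weightedCount Y top k α) q ∎
      where
      open ≡-Reasoning
      q = (top C k) * length (cells Y top)
      weight-of-cell : ∀ σ → isCell Y k σ ∧ α σ ≡ true → weight Y top σ ≡ divℚ (count Y top σ) q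
      weight-of-cell σ cellσ = cong (λ m → divℚ (count Y top σ) ((top C m) * length (cells Y top)))
                                    (cell-size Y k σ (∧-conicalˡ (isCell Y k σ) (α σ) cellσ))

    cellCount-iso : (Y Z : Faces n) → Isomorphic Y Z → (k : ℕ) → length (cells Y k) ≡ length (cells Z k)
    cellCount-iso Y Z (π , Z∘π≡Y) k = begin
      length (cells Y k)                           ≡⟨ cellCount-as-∑ Y k ⟩
      ∑[ σ ← 𝒮 ] (𝟙 (isCell Y k σ) * 1)            ≡⟨ ∑-cong 𝒮 (λ σ → cong₂ (λ b m → 𝟙 (b ∧ (m ≡ᵇ k)) * 1)
                                                          (sym (Z∘π≡Y σ)) (sym (size-image π σ))) ⟩
      ∑[ σ ← 𝒮 ] (𝟙 (isCell Z k (image π σ)) * 1)  ≡⟨ ∑-image π (λ σ → 𝟙 (isCell Z k σ) * 1) ⟩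
      ∑[ σ ← 𝒮 ] (𝟙 (isCell Z k σ) * 1)            ≡⟨ cellCount-as-∑ Z k ⟨
      length (cells Z k)                           ∎
      where open ≡-Reasoning

  module _ {n : ℕ} (X : Faces n) (v : Fin n) where

    link-cell : ∀ k ρ → isCell (link X v) k ρ ≡ not (lookup ρ v) ∧ isCell X (suc k) (ρ ∪ ⁅ v ⁆)
    link-cell k ρ with lookup ρ v in v∈?ρ
    ... | true  = refl
    ... | false = cong (λ m → X (ρ ∪ ⁅ v ⁆) ∧ (m ≡ᵇ suc k)) (sym (size-insert ρ v (not-lookup⇒∉ (cong not v∈?ρ))))

    ∑-over-link : ∀ k (g G : Subset n → ℕ) → (∀ ρ → v ∉ ρ → g ρ ≡ G (ρ ∪ ⁅ v ⁆)) →
      ∑[ ρ ← 𝒮 ] (𝟙 (isCell (link X v) k ρ) * g ρ) ≡ ∑[ σ ← 𝒮 ] (𝟙 (lookup σ v) * (𝟙 (isCell X (suc k) σ) * G σ))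
    ∑-over-link k g G g≡G = trans (∑-cong 𝒮 transport) (∑-insert v (λ σ → 𝟙 (isCell X (suc k) σ) * G σ))
      where
      transport : ∀ ρ → 𝟙 (isCell (link X v) k ρ) * g ρ
                          ≡ 𝟙 (not (lookup ρ v)) * (𝟙 (isCell X (suc k) (ρ ∪ ⁅ v ⁆)) * G (ρ ∪ ⁅ v ⁆))
      transport ρ = begin
        𝟙 (isCell (link X v) k ρ) * g ρ           ≡⟨ cong (λ b → 𝟙 b * g ρ) (link-cell k ρ) ⟩
        𝟙 (not (lookup ρ v) ∧ c) * g ρ            ≡⟨ cong (_* g ρ) (𝟙-∧ (not (lookup ρ v)) c) ⟩
        𝟙 (not (lookup ρ v)) * 𝟙 c * g ρ          ≡⟨ *-assoc (𝟙 (not (lookup ρ v))) (𝟙 c) (g ρ) ⟩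
        𝟙 (not (lookup ρ v)) * (𝟙 c * g ρ)        ≡⟨ 𝟙-guard (not (lookup ρ v))
                                                       (λ v∉ρ → cong (𝟙 c *_) (g≡G ρ (not-lookup⇒∉ v∉ρ))) ⟩
        𝟙 (not (lookup ρ v)) * (𝟙 c * G (ρ ∪ ⁅ v ⁆)) ∎
        where
        open ≡-Reasoning
        c = isCell X (suc k) (ρ ∪ ⁅ v ⁆)

    count-in-link : ∀ k τ → v ∉ τ → count (link X v) k τ ≡ count X (suc k) (τ ∪ ⁅ v ⁆)
    count-in-link k τ v∉τ = begin
      count (link X v) k τ
        ≡⟨ count-as-∑ (link X v) k τ ⟩
      ∑[ ρ ← 𝒮 ] (𝟙 (isCell (link X v) k ρ) * 𝟙 ⌊ τ ⊆? ρ ⌋)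
        ≡⟨ ∑-over-link k _ (λ σ → 𝟙 ⌊ τ ∪ ⁅ v ⁆ ⊆? σ ⌋) (λ ρ _ → cong 𝟙 (⊆-insert τ ρ v v∉τ)) ⟩
      ∑[ σ ← 𝒮 ] (𝟙 (lookup σ v) * (𝟙 (isCell X (suc k) σ) * 𝟙 ⌊ τ ∪ ⁅ v ⁆ ⊆? σ ⌋))
        ≡⟨ ∑-cong 𝒮 contains-v ⟩
      ∑[ σ ← 𝒮 ] (𝟙 (isCell X (suc k) σ) * 𝟙 ⌊ τ ∪ ⁅ v ⁆ ⊆? σ ⌋)
        ≡⟨ count-as-∑ X (suc k) (τ ∪ ⁅ v ⁆) ⟨
      count X (suc k) (τ ∪ ⁅ v ⁆) ∎
      where
      open ≡-Reasoning
      -- A cell above τ ∪ {v} contains v, so the extra factor 𝟙 (v ∈ σ) is redundant.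
      contains-v : ∀ σ → 𝟙 (lookup σ v) * (𝟙 (isCell X (suc k) σ) * 𝟙 ⌊ τ ∪ ⁅ v ⁆ ⊆? σ ⌋)
                           ≡ 𝟙 (isCell X (suc k) σ) * 𝟙 ⌊ τ ∪ ⁅ v ⁆ ⊆? σ ⌋
      contains-v σ with τ ∪ ⁅ v ⁆ ⊆? σ
      ... | yes τv⊆σ rewrite ∈⇒lookup (τv⊆σ (∈⁅⁆∪ τ v)) = +-identityʳ _
      ... | no _     = trans (cong (𝟙 (lookup σ v) *_) (*-zeroʳ c)) (trans (*-zeroʳ (𝟙 (lookup σ v))) (sym (*-zeroʳ c)))
        where c = 𝟙 (isCell X (suc k) σ)

    cellCount-link : ∀ k → length (cells (link X v) k) ≡ ∑[ σ ← 𝒮 ] (𝟙 (lookup σ v) * (𝟙 (isCell X (suc k) σ) * 1))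
    cellCount-link k = trans (cellCount-as-∑ (link X v) k) (∑-over-link k (λ _ → 1) (λ _ → 1) (λ _ _ → refl))

    weightedCount-link : ∀ top k (α : Subset n → Bool) → weightedCount (link X v) top k (restrict α v)
      ≡ ∑[ σ ← 𝒮 ] (𝟙 (lookup σ v) * (𝟙 (isCell X (suc k) σ) * (𝟙 (α σ) * count X (suc top) σ)))
    weightedCount-link top k α = ∑-over-link k _ (λ σ → 𝟙 (α σ) * count X (suc top) σ)
      (λ ρ v∉ρ → cong (𝟙 (α (ρ ∪ ⁅ v ⁆)) *_) (count-in-link top ρ v∉ρ))

  module _ {n : ℕ} (X : Faces n) (complex : IsSimplicialComplex X) where
    open IsSimplicialComplex complex

    -- Every vertex of a face is a vertex of X.
    vertex-degree : ∀ σ → X σ ≡ true → ∑[ v ← allFin n ] (𝟙 (X ⁅ v ⁆) * 𝟙 (lookup σ v)) ≡ ∣ σ ∣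
    vertex-degree σ Xσ = trans (∑-cong (allFin n) vertex-of-face) (sym (size-as-∑ σ))
      where
      vertex-of-face : ∀ v → 𝟙 (X ⁅ v ⁆) * 𝟙 (lookup σ v) ≡ 𝟙 (lookup σ v)
      vertex-of-face v with lookup σ v in v∈σ
      ... | true rewrite downClosed σ ⁅ v ⁆ (Equivalence.from (⁅⁆⊆⇔∈ σ v) (lookup⇒∈ v∈σ)) Xσ = refl
      ... | false = *-zeroʳ (𝟙 (X ⁅ v ⁆))

    -- Double counting of the incidences (v, σ) with v ∈ σ ∈ X(k-1): each cell has k vertices.
    double-count : ∀ k (g : Subset n → ℕ) →
      ∑[ v ← allFin n ] (𝟙 (X ⁅ v ⁆) * ∑[ σ ← 𝒮 ] (𝟙 (lookup σ v) * (𝟙 (isCell X k σ) * g σ)))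
        ≡ k * ∑[ σ ← 𝒮 ] (𝟙 (isCell X k σ) * g σ)
    double-count k g = begin
      ∑[ v ← allFin n ] (𝟙 (X ⁅ v ⁆) * ∑[ σ ← 𝒮 ] (𝟙 (lookup σ v) * h σ))
        ≡⟨ ∑-cong (allFin n) (λ v → ∑-*ˡ 𝒮 (𝟙 (X ⁅ v ⁆)) (λ σ → 𝟙 (lookup σ v) * h σ)) ⟨
      ∑[ v ← allFin n ] ∑[ σ ← 𝒮 ] (𝟙 (X ⁅ v ⁆) * (𝟙 (lookup σ v) * h σ))
        ≡⟨ ∑-swap (allFin n) (𝒮 {n}) _ ⟩
      ∑[ σ ← 𝒮 ] ∑[ v ← allFin n ] (𝟙 (X ⁅ v ⁆) * (𝟙 (lookup σ v) * h σ))
        ≡⟨ ∑-cong 𝒮 (λ σ → trans (∑-cong (allFin n) (λ v → sym (*-assoc (𝟙 (X ⁅ v ⁆)) _ (h σ))))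
                                  (∑-*ʳ (allFin n) (h σ) (λ v → 𝟙 (X ⁅ v ⁆) * 𝟙 (lookup σ v)))) ⟩
      ∑[ σ ← 𝒮 ] (∑[ v ← allFin n ] (𝟙 (X ⁅ v ⁆) * 𝟙 (lookup σ v)) * h σ)
        ≡⟨ ∑-cong 𝒮 k-vertices ⟩
      ∑[ σ ← 𝒮 ] (k * h σ)
        ≡⟨ ∑-*ˡ 𝒮 k h ⟩
      k * ∑[ σ ← 𝒮 ] h σ ∎
      where
      open ≡-Reasoning
      h : Subset n → ℕ
      h σ = 𝟙 (isCell X k σ) * g σ
      k-vertices : ∀ σ → ∑[ v ← allFin n ] (𝟙 (X ⁅ v ⁆) * 𝟙 (lookup σ v)) * h σ ≡ k * h σ
      k-vertices σ with isCell X k σ in cellσ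
      ... | true  = cong (_* (g σ + 0)) (trans (vertex-degree σ (cell-face X k σ cellσ)) (cell-size X k σ cellσ))
      ... | false = trans (*-zeroʳ (∑[ v ← allFin n ] (𝟙 (X ⁅ v ⁆) * 𝟙 (lookup σ v)))) (sym (*-zeroʳ k))

  module Averaging {n d : ℕ} (X : Faces n) (complex : IsSimplicialComplex X) (pure : IsPure d X)
    (homogeneous : Homogeneous X) where

    open IsSimplicialComplex complex
    open IsPure pure

    T : ℕ
    T = length (cells X (suc d))

    N : ℕ
    N = length (vertices X)

    τ₀ : Subset n
    τ₀ = proj₁ (extends ⊥ hasEmpty)

    X-τ₀ : X τ₀ ≡ true
    X-τ₀ = proj₁ (proj₂ (proj₂ (extends ⊥ hasEmpty)))

    size-τ₀ : ∣ τ₀ ∣ ≡ suc d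
    size-τ₀ = proj₂ (proj₂ (proj₂ (extends ⊥ hasEmpty)))

    instance
      T-nonZero : NonZero T
      T-nonZero = >-nonZero (begin
        1                                      ≡⟨ cong (λ b → 𝟙 b * 1) τ₀-cell ⟨
        𝟙 (isCell X (suc d) τ₀) * 1            ≤⟨ SubsetEnumeration.term≤∑ (λ σ → 𝟙 (isCell X (suc d) σ) * 1) τ₀ ⟩
        ∑[ σ ← 𝒮 ] (𝟙 (isCell X (suc d) σ) * 1) ≡⟨ cellCount-as-∑ X (suc d) ⟨
        T                                      ∎)
        where
        open ≤-Reasoning
        τ₀-cell : isCell X (suc d) τ₀ ≡ true
        τ₀-cell rewrite X-τ₀ | size-τ₀ = Equivalence.to T-≡ (≡⇒≡ᵇ (suc d) (suc d) refl)

    v₀ : Fin n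
    v₀ = proj₁ (member-of-nonempty τ₀ size-τ₀)

    X-v₀ : X ⁅ v₀ ⁆ ≡ true
    X-v₀ = downClosed τ₀ ⁅ v₀ ⁆
      (Equivalence.from (⁅⁆⊆⇔∈ τ₀ v₀) (lookup⇒∈ (proj₂ (member-of-nonempty τ₀ size-τ₀)))) X-τ₀

    D : ℕ
    D = length (cells (link X v₀) d)

    link-size : ∀ v → X ⁅ v ⁆ ≡ true → length (cells (link X v) d) ≡ D
    link-size v X-v = cellCount-iso (link X v) (link X v₀) (homogeneous v v₀ X-v X-v₀) d

    -- Counting the pairs (vertex, top cell through it) in two ways: N D = (d+1) T.
    incidences : N * D ≡ suc d * T
    incidences = begin
      length (vertices X) * D
        ≡⟨ ∑-const (vertices X) D ⟨
      ∑[ v ← vertices X ] D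
        ≡⟨ ∑-select (λ v → X ⁅ v ⁆) (allFin n) (λ _ → D) ⟩
      ∑[ v ← allFin n ] (𝟙 (X ⁅ v ⁆) * D)
        ≡⟨ ∑-cong (allFin n) (λ v → 𝟙-guard (X ⁅ v ⁆) (λ X-v → trans (sym (link-size v X-v)) (cellCount-link X v d))) ⟩
      ∑[ v ← allFin n ] (𝟙 (X ⁅ v ⁆) * ∑[ σ ← 𝒮 ] (𝟙 (lookup σ v) * (𝟙 (isCell X (suc d) σ) * 1)))
        ≡⟨ double-count X complex (suc d) (λ _ → 1) ⟩
      suc d * ∑[ σ ← 𝒮 ] (𝟙 (isCell X (suc d) σ) * 1)
        ≡⟨ cong (suc d *_) (cellCount-as-∑ X (suc d)) ⟨
      suc d * T ∎
      where open ≡-Reasoning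

    -- N D = (d+1) T > 0, so N and D are positive.
    ND-nonZero : NonZero (N * D)
    ND-nonZero = subst NonZero (sym incidences) (m*n≢0 (suc d) T)

    instance
      N-nonZero : NonZero N
      N-nonZero = m*n≢0⇒m≢0 N {{ND-nonZero}}

      D-nonZero : NonZero D
      D-nonZero = m*n≢0⇒n≢0 N {{ND-nonZero}}

    linkWeightSum : ℕ → (Subset n → Bool) → ℕ
    linkWeightSum i α = ∑[ v ← allFin n ] (𝟙 (X ⁅ v ⁆) * weightedCount (link X v) d i (restrict α v))

    -- Counting the pairs (vertex, cell through it) weighted by α and c_X: Σ_v A_v = (i+1) A.
    link-weights : ∀ i (α : Subset n → Bool) → linkWeightSum i α ≡ suc i * weightedCount X (suc d) (suc i) α
    link-weights i α = trans
      (∑-cong (allFin n) (λ v → cong (𝟙 (X ⁅ v ⁆) *_) (weightedCount-link X v d i α)))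
      (double-count X complex (suc i) (λ σ → 𝟙 (α σ) * count X (suc d) σ))

    -- All links have the denominator C(d,i) D, so their norms add up to one fraction.
    sum-of-link-norms : ∀ i (α : Subset n → Bool) →
      sumℚ (map (λ v → norm (link X v) d i (restrict α v)) (vertices X)) ≡ divℚ (linkWeightSum i α) ((d C i) * D)
    sum-of-link-norms i α = sum-of-fractions (λ v → X ⁅ v ⁆) _ _ ((d C i) * D) (allFin n) link-norm
      where
      link-norm : ∀ v → X ⁅ v ⁆ ≡ true →
        norm (link X v) d i (restrict α v) ≡ divℚ (weightedCount (link X v) d i (restrict α v)) ((d C i) * D)
      link-norm v X-v = trans (norm-as-fraction (link X v) d i (restrict α v))
        (cong (λ m → divℚ (weightedCount (link X v) d i (restrict α v)) ((d C i) * m)) (link-size v X-v))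

    norm-via-links : ∀ i → i ≤ d → (α : Subset n → Bool) →
      norm X (suc d) (suc i) α ≡ divℚ 1 N *ℚ divℚ (linkWeightSum i α) ((d C i) * D)
    norm-via-links i i≤d α = begin
      norm X (suc d) (suc i) α                ≡⟨ norm-as-fraction X (suc d) (suc i) α ⟩
      divℚ A (c′ * T)                         ≡⟨ divℚ-cross A (1 * B) (c′ * T) (N * (c * D))
                                                   {{m*n≢0 c′ T}} {{m*n≢0 N (c * D) {{N-nonZero}} {{m*n≢0 c D}}}}
                                                   (averaging-arithmetic i d A B N D T (link-weights i α) incidences) ⟩
      divℚ (1 * B) (N * (c * D))              ≡⟨ divℚ-* 1 B N (c * D) ⟨
      divℚ 1 N *ℚ divℚ B (c * D)              ∎
      where
      open ≡-Reasoning
      A = weightedCount X (suc d) (suc i) α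
      B = linkWeightSum i α
      c = d C i
      c′ = suc d C suc i
      instance
        c-nonZero : NonZero c
        c-nonZero = >-nonZero (binomial-positive i≤d)
        c′-nonZero : NonZero c′
        c′-nonZero = >-nonZero (binomial-positive (s≤s i≤d))

open import Data.Nat using (ℕ; suc; _≤_)
open import Data.Bool using (Bool)
open import Data.List using (map; length)
open import Data.Rational using (_*_)
open import Data.Fin.Subset using (Subset)
open import Relation.Binary.PropositionalEquality using (_≡_; trans; sym; cong)
open Complexes using (module Averaging)

lemma2p3 : (n d : ℕ) (X : Faces n) → IsSimplicialComplex X → IsPure d X → Homogeneous X →
    (i : ℕ) → i ≤ d → (α : Subset n → Bool) →
    norm X (suc d) (suc i) α
      ≡ divℚ 1 (length (vertices X)) * sumℚ (map (λ v → norm (link X v) d i (restrict α v)) (vertices X))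
lemma2p3 n d X complex pure homogeneous i i≤d α =
  trans (norm-via-links i i≤d α) (cong (divℚ 1 N *_) (sym (sum-of-link-norms i α)))
  where open Averaging X complex pure homogeneous
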